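{- Let $n\ge 3$, let $\Sigma$ be a finite set with $|\Sigma|=k$, and let $\Omega\subset\Sigma$ be a nonempty subset with $|\Omega|\le\lfloor k/2\rfloor$. Then there exists a reducible $n$-quasigroup $q:\Sigma^n\to\Sigma$ which is $\Omega$-closed, i.e., whose restriction $q|_{\Omega^n}$ is an $n$-quasigroup $\Omega^n\to\Omega$.
   Context: For a nonempty set $\Sigma$ and a positive integer $n$, an $n$-ary operation $f:\Sigma^n\to\Sigma$ is an $n$-quasigroup if in the equality $z_0=f(z_1,\ldots,z_n)$ knowledge of any $n$ of the elements $z_0,\ldots,z_n$ uniquely specifies the remaining one. An $n$-quasigroup $f$ is reducible if there exist an integer $k$ with $1<k<n$, a permutation $\sigma$ of $\{1,\ldots,n\}$, an $(n-k+1)$-quasigroup $h$ and a $k$-quasigroup $g$ on $\Sigma$ such that $f(x_1,\ldots,x_n)=h\big(g(x_{\sigma(1)},\ldots,x_{\sigma(k)}),x_{\sigma(k+1)},\ldots,x_{\sigma(n)}\big)$ identically. For $\Omega\subset\Sigma$, an $n$-quasigroup $q$ on $\Sigma$ is $\Omega$-closed if $q|_{\Omega^n}$ is an $n$-quasigroup on $\Omega$ (a subquasigroup of $q$). -}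

module Defs where

open import Level using (Level; _⊔_)
open import Data.Nat using (ℕ; suc; _+_; _≤_)
open import Data.Fin using (Fin)
open import Data.Fin.Permutation using (Permutation; _⟨$⟩ʳ_)
open import Data.Product using (Σ; ∃; ∃-syntax; ∃!; _×_; _,_)
open import Data.Vec.Functional using (Vector; updateAt; take; drop; _∷_)
open import Function using (_∘_; const)
open import Relation.Binary.PropositionalEquality using (_≡_)

private variable a ℓ : Level

Op : ℕ → Set a → Set a
Op n A = Vector A n → A

-- n-quasigroup: in z₀ = f(z₁,…,zₙ), any n of the elements uniquely determine the
-- remaining one.  z₀ is always determined (f is a function); for each argument
-- position i, given the other arguments and z₀ there is exactly one value of zᵢ.
IsQuasigroup : {A : Set a} (n : ℕ) → Op n A → Set a
IsQuasigroup {A = A} n f =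
  ∀ (i : Fin n) (xs : Vector A n) (z : A) →
    ∃! _≡_ (λ y → f (updateAt xs i (const y)) ≡ z)

IsReducible : {A : Set a} (n : ℕ) → Op n A → Set a
IsReducible {A = A} n f =
  ∃[ m ] ∃[ r ] (2 ≤ m) × (1 ≤ r) × Σ (m + r ≡ n) λ _ →
    Σ (Permutation (m + r) n) λ σ →
    Σ (Op (suc r) A) λ h → Σ (Op m A) λ g →
      IsQuasigroup (suc r) h × IsQuasigroup m g ×
      (∀ (xs : Vector A n) →
         f xs ≡ h (g (take m (xs ∘ (σ ⟨$⟩ʳ_))) ∷ drop m (xs ∘ (σ ⟨$⟩ʳ_))))

IsClosed : {A : Set a} (n : ℕ) → (A → Set ℓ) → Op n A → Set (a ⊔ ℓ)
IsClosed {A = A} n Ω f =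
  (∀ (xs : Vector A n) → (∀ j → Ω (xs j)) → Ω (f xs)) ×
  (∀ (i : Fin n) (xs : Vector A n) → (∀ j → Ω (xs j)) → (z : A) → Ω z →
     ∃ λ y → Ω y × f (updateAt xs i (const y)) ≡ z ×
       (∀ y' → Ω y' → f (updateAt xs i (const y')) ≡ z → y ≡ y'))

-- A binary quasigroup ∙ on Fin k yields the reducible n-quasigroup
-- (⋯((x₁ ∙ x₂) ∙ x₃) ⋯) ∙ xₙ, which is Ω-closed whenever Ω is a subquasigroup of ∙.
-- So it suffices to find a Latin square of order k = m + t, where m = ∣Ω∣ ≤ t, with
-- a subsquare of order m.  It is a prolongation of the square (a , b) ↦ a + ρ (b − a)
-- over ℤ_t, ρ an orthomorphism: the cells with ρ (b − a) in a fixed m-set D form m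
-- disjoint transversals; their entries are moved to m new rows and columns, the
-- cells themselves receive m new symbols, and the new m × m corner is ℤ_m.  For even
-- t, ℤ_t has no orthomorphism, but one failing at a single value of ρ suffices,
-- provided that value lies in D: its cell is displaced anyway.

module Submission where

open import Defs
open import Level using (Level; _⊔_; 0ℓ)
open import Algebra.Bundles using (Group)
open import Algebra.Core using (Op₁; Op₂)
open import Algebra.Definitions using (LeftCancellative; RightCancellative)
open import Algebra.Structures using (IsGroup)
import Algebra.Properties.Group as GroupProperties
import Algebra.Properties.Quasigroup as QuasigroupProperties
open import Data.Nat as ℕ using (ℕ; zero; suc; _+_; _*_; _∸_; _≤_; _<_; _/_; _%_; z≤n; s≤s)
import Data.Nat.Properties as ℕ
open import Data.Nat.DivMod
  using (_mod_; %-distribˡ-+; m%n%n≡m%n; m<n⇒m%n≡m; n%n≡0; [m+n]%n≡m%n; m/n*n≤m)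
open import Data.Nat.Tactic.RingSolver using (solve-∀)
open import Data.Fin using (Fin; zero; suc; toℕ; punchOut; _≟_; splitAt; join; _↑ˡ_; _↑ʳ_; fromℕ; inject₁)
open import Data.Fin.Properties using (any?; punchOut-injective; injective⇒≤; toℕ-fromℕ<; toℕ-injective;
  toℕ<n; toℕ-↑ˡ; toℕ-↑ʳ; toℕ-inject₁; splitAt-↑ˡ; splitAt-↑ʳ; splitAt⁻¹-↑ˡ; join-splitAt; splitAt-join;
  fromℕ≢inject₁; inject₁-injective)
import Data.Fin.Permutation as Permutation
open import Data.Fin.Subset using (Subset; _∈_; _∉_; ∣_∣; ∁; Nonempty; inside; outside)
open import Data.Fin.Subset.Properties using (_∈?_; ∣∁p∣≡n∸∣p∣)
open import Data.Maybe using (Maybe; just; nothing; maybe′)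
open import Data.Maybe.Properties using (just-injective)
open import Data.Product using (Σ; ∃; _×_; _,_)
open import Data.Sum using (_⊎_; inj₁; inj₂; [_,_]′; map₁; map₂)
open import Data.Sum.Properties using (inj₁-injective; inj₂-injective)
open import Data.Unit using (⊤; tt)
open import Data.Vec using (_∷_; here; there)
open import Data.Vec.Functional as Vector using (Vector; head; tail; foldl; updateAt)
open import Function using (_∘_; id; const)
open import Function.Definitions using (Injective)
open import Relation.Nullary using (¬_; yes; no)
open import Relation.Nullary.Decidable using (decidable-stable)
open import Relation.Nullary.Negation using (contradiction)
open import Relation.Unary using (Pred; Decidable)
open import Relation.Binary.PropositionalEquality

private variable a ℓ : Level

-- Iterated binary operations

UniqueIn : {A : Set a} → (A → Set ℓ) → (A → Set a) → Set (a ⊔ ℓ)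
UniqueIn O P = ∃ λ y → O y × P y × (∀ y' → O y' → P y' → y ≡ y')

UniqueIn-∘ : {A : Set a} {O : A → Set ℓ} {P : A → Set a} (g : A → A) →
  (∀ {y} → O y → O (g y)) → UniqueIn O P →
  (∀ {w} → O w → UniqueIn O (λ y → g y ≡ w)) → UniqueIn O (λ y → P (g y))
UniqueIn-∘ {P = P} g O-g (w , Ow , Pw , w-unique) g-solvable
  with y , Oy , gy≡w , y-unique ← g-solvable Ow =
  y , Oy , subst P (sym gy≡w) Pw ,
  λ y' Oy' Pgy' → y-unique y' Oy' (sym (w-unique (g y') (O-g Oy') Pgy'))

record IsSubquasigroup₂ {A : Set a} (O : A → Set ℓ) (_∙_ : Op₂ A) : Set (a ⊔ ℓ) where
  field
    closed : ∀ {x y} → O x → O y → O (x ∙ y)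
    solveʳ : ∀ {x z} → O x → O z → UniqueIn O (λ y → x ∙ y ≡ z)
    solveˡ : ∀ {y z} → O y → O z → UniqueIn O (λ x → x ∙ y ≡ z)

chain : {A : Set a} → Op₂ A → (r : ℕ) → Op (suc r) A
chain _∙_ r xs = foldl _∙_ (head xs) (tail xs)

-- chain (suc r) xs reduces to chain r ((xs 0 ∙ xs 1) ∷ tail (tail xs)), also after an
-- updateAt, so the induction below needs no congruence lemma for chain.
module _ {A : Set a} {O : A → Set ℓ} {_∙_ : Op₂ A} (sub : IsSubquasigroup₂ O _∙_) where
  open IsSubquasigroup₂ sub

  private
    All : ∀ {n} → Vector A n → Set ℓ
    All xs = ∀ j → O (xs j)

    contract : ∀ {r} {xs : Vector A (suc (suc r))} → All xs →
      All ((xs zero ∙ xs (suc zero)) Vector.∷ tail (tail xs))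
    contract Oxs zero    = closed (Oxs zero) (Oxs (suc zero))
    contract Oxs (suc j) = Oxs (suc (suc j))

  chain-closed : ∀ r (xs : Vector A (suc r)) → All xs → O (chain _∙_ r xs)
  chain-closed zero    xs Oxs = Oxs zero
  chain-closed (suc r) xs Oxs = chain-closed r _ (contract Oxs)

  chain-solvable : ∀ r (i : Fin (suc r)) (xs : Vector A (suc r)) → All xs → ∀ z → O z →
    UniqueIn O (λ y → chain _∙_ r (updateAt xs i (const y)) ≡ z)
  chain-solvable zero zero xs Oxs z Oz = z , Oz , refl , λ _ _ → sym
  chain-solvable (suc r) zero xs Oxs z Oz =
    UniqueIn-∘ (_∙ xs (suc zero)) (λ Oy → closed Oy (Oxs (suc zero)))
      (chain-solvable r zero _ (contract Oxs) z Oz) (solveˡ (Oxs (suc zero)))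
  chain-solvable (suc r) (suc zero) xs Oxs z Oz =
    UniqueIn-∘ (xs zero ∙_) (closed (Oxs zero))
      (chain-solvable r zero _ (contract Oxs) z Oz) (solveʳ (Oxs zero))
  chain-solvable (suc r) (suc (suc i)) xs Oxs z Oz =
    chain-solvable r (suc i) _ (contract Oxs) z Oz

  isClosed-chain : ∀ r → IsClosed (suc r) O (chain _∙_ r)
  isClosed-chain r = chain-closed r , chain-solvable r

isQuasigroup-chain : {A : Set a} {_∙_ : Op₂ A} → IsSubquasigroup₂ (λ _ → ⊤) _∙_ →
  ∀ r → IsQuasigroup (suc r) (chain _∙_ r)
isQuasigroup-chain quasigroup r i xs z
  with y , _ , eq , unique ← chain-solvable quasigroup r i xs (λ _ → tt) z tt =
  y , eq , λ eq' → unique _ tt eq'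

isReducible-chain : {A : Set a} {_∙_ : Op₂ A} → IsSubquasigroup₂ (λ _ → ⊤) _∙_ →
  ∀ r → IsReducible (suc (suc (suc r))) (chain _∙_ (suc (suc r)))
isReducible-chain {_∙_ = _∙_} quasigroup r =
  2 , suc r , s≤s (s≤s z≤n) , s≤s z≤n , refl , Permutation.id , chain _∙_ (suc r) , chain _∙_ 1 ,
  isQuasigroup-chain quasigroup (suc r) , isQuasigroup-chain quasigroup 1 , λ _ → refl

-- Finite cancellative operations

injective⇒surjective : ∀ {k} {f : Fin k → Fin k} → Injective _≡_ _≡_ f → ∀ z → ∃ λ y → f y ≡ z
injective⇒surjective {suc k} {f} f-injective z with any? (λ y → f y ≟ z)
... | yes solution = solution
... | no z∉image = contradiction (injective⇒≤ punchOut∘f-injective) ℕ.1+n≰n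
  where
  z≢f : ∀ y → z ≢ f y
  z≢f y z≡fy = z∉image (y , sym z≡fy)
  punchOut∘f-injective : Injective _≡_ _≡_ (λ y → punchOut (z≢f y))
  punchOut∘f-injective = f-injective ∘ punchOut-injective (z≢f _) (z≢f _)

module FiniteCancellative {k} {_∙_ : Op₂ (Fin k)}
  (cancelˡ : LeftCancellative _≡_ _∙_) (cancelʳ : RightCancellative _≡_ _∙_) where

  private
    solutionʳ : ∀ x z → ∃ λ y → x ∙ y ≡ z
    solutionʳ x = injective⇒surjective (cancelˡ x _ _)

    solutionˡ : ∀ y z → ∃ λ x → x ∙ y ≡ z
    solutionˡ y = injective⇒surjective (cancelʳ y _ _)

  isSubquasigroup₂-⊤ : IsSubquasigroup₂ (λ _ → ⊤) _∙_
  isSubquasigroup₂-⊤ = record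
    { closed = λ _ _ → tt
    ; solveʳ = λ {x} {z} _ _ → let y , eq = solutionʳ x z in
        y , tt , eq , λ _ _ eq' → cancelˡ x _ _ (trans eq (sym eq'))
    ; solveˡ = λ {y} {z} _ _ → let x , eq = solutionˡ y z in
        x , tt , eq , λ _ _ eq' → cancelʳ y _ _ (trans eq (sym eq'))
    }

  -- The solution in Fin k lies in O, since otherwise an absorption law would put z outside O.
  isSubquasigroup₂ : ∀ {O : Pred (Fin k) ℓ} → Decidable O →
    (∀ {x y} → O x → O y → O (x ∙ y)) →
    (∀ {x y} → O x → ¬ O y → ¬ O (x ∙ y)) →
    (∀ {x y} → ¬ O x → O y → ¬ O (x ∙ y)) →
    IsSubquasigroup₂ O _∙_
  isSubquasigroup₂ {O = O} O? closed absorbʳ absorbˡ = record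
    { closed = closed
    ; solveʳ = λ {x} {z} Ox Oz → let y , eq = solutionʳ x z in
        y , decidable-stable (O? y) (λ ¬Oy → absorbʳ Ox ¬Oy (subst O (sym eq) Oz)) , eq ,
        λ _ _ eq' → cancelˡ x _ _ (trans eq (sym eq'))
    ; solveˡ = λ {y} {z} Oy Oz → let x , eq = solutionˡ y z in
        x , decidable-stable (O? x) (λ ¬Ox → absorbˡ ¬Ox Oy (subst O (sym eq) Oz)) , eq ,
        λ _ _ eq' → cancelʳ y _ _ (trans eq (sym eq'))
    }

-- Cyclic groups

module Cyclic (n : ℕ) where

  infixl 6 _⊕_
  infix 8 ⊖_

  _⊕_ : Op₂ (Fin (suc n))
  a ⊕ b = (toℕ a + toℕ b) mod suc n

  ⊖_ : Op₁ (Fin (suc n))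
  ⊖ a = (suc n ∸ toℕ a) mod suc n

  toℕ-mod : ∀ m → toℕ (m mod suc n) ≡ m % suc n
  toℕ-mod m = toℕ-fromℕ< _

  mod-cong : ∀ m m' → m % suc n ≡ m' % suc n → m mod suc n ≡ m' mod suc n
  mod-cong m m' eq = toℕ-injective (trans (toℕ-mod m) (trans eq (sym (toℕ-mod m'))))

  mod-injective : ∀ {m m'} → m < suc n → m' < suc n → m mod suc n ≡ m' mod suc n → m ≡ m'
  mod-injective {m} {m'} m<n m'<n eq = begin
    m                  ≡⟨ m<n⇒m%n≡m m<n ⟨
    m % suc n          ≡⟨ toℕ-mod m ⟨
    toℕ (m mod suc n)  ≡⟨ cong toℕ eq ⟩
    toℕ (m' mod suc n) ≡⟨ toℕ-mod m' ⟩
    m' % suc n         ≡⟨ m<n⇒m%n≡m m'<n ⟩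
    m'                 ∎
    where open ≡-Reasoning

  mod-+-modulus : ∀ m → (m + suc n) mod suc n ≡ m mod suc n
  mod-+-modulus m = mod-cong (m + suc n) m ([m+n]%n≡m%n m (suc n))

  private
    [m%n+k]%n≡[m+k]%n : ∀ m k → (m % suc n + k) % suc n ≡ (m + k) % suc n
    [m%n+k]%n≡[m+k]%n m k = begin
      (m % suc n + k) % suc n                 ≡⟨ %-distribˡ-+ (m % suc n) k (suc n) ⟩
      (m % suc n % suc n + k % suc n) % suc n ≡⟨ cong (λ x → (x + k % suc n) % suc n) (m%n%n≡m%n m _) ⟩
      (m % suc n + k % suc n) % suc n         ≡⟨ %-distribˡ-+ m k (suc n) ⟨
      (m + k) % suc n                         ∎
      where open ≡-Reasoning

    [a⊕b]⊕c : ∀ a b c → (a ⊕ b) ⊕ c ≡ (toℕ a + toℕ b + toℕ c) mod suc n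
    [a⊕b]⊕c a b c = mod-cong (toℕ (a ⊕ b) + toℕ c) (toℕ a + toℕ b + toℕ c)
      (trans (cong (λ x → (x + toℕ c) % suc n) (toℕ-mod (toℕ a + toℕ b)))
             ([m%n+k]%n≡[m+k]%n (toℕ a + toℕ b) (toℕ c)))

  ⊕-comm : ∀ a b → a ⊕ b ≡ b ⊕ a
  ⊕-comm a b = cong (_mod suc n) (ℕ.+-comm (toℕ a) (toℕ b))

  ⊕-assoc : ∀ a b c → (a ⊕ b) ⊕ c ≡ a ⊕ (b ⊕ c)
  ⊕-assoc a b c = begin
    (a ⊕ b) ⊕ c                          ≡⟨ [a⊕b]⊕c a b c ⟩
    (toℕ a + toℕ b + toℕ c) mod suc n    ≡⟨ cong (_mod suc n) (ℕ.+-assoc (toℕ a) (toℕ b) (toℕ c)) ⟩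
    (toℕ a + (toℕ b + toℕ c)) mod suc n  ≡⟨ cong (_mod suc n) (ℕ.+-comm (toℕ a) (toℕ b + toℕ c)) ⟩
    (toℕ b + toℕ c + toℕ a) mod suc n    ≡⟨ [a⊕b]⊕c b c a ⟨
    (b ⊕ c) ⊕ a                          ≡⟨ ⊕-comm (b ⊕ c) a ⟩
    a ⊕ (b ⊕ c)                          ∎
    where open ≡-Reasoning

  ⊕-identityˡ : ∀ a → zero ⊕ a ≡ a
  ⊕-identityˡ a = toℕ-injective (trans (toℕ-mod (toℕ a)) (m<n⇒m%n≡m (toℕ<n a)))

  ⊖-inverseˡ : ∀ a → ⊖ a ⊕ a ≡ zero
  ⊖-inverseˡ a = mod-cong (toℕ (⊖ a) + toℕ a) 0 (begin
    (toℕ (⊖ a) + toℕ a) % suc n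
      ≡⟨ cong (λ x → (x + toℕ a) % suc n) (toℕ-mod (suc n ∸ toℕ a)) ⟩
    ((suc n ∸ toℕ a) % suc n + toℕ a) % suc n
      ≡⟨ [m%n+k]%n≡[m+k]%n (suc n ∸ toℕ a) (toℕ a) ⟩
    (suc n ∸ toℕ a + toℕ a) % suc n
      ≡⟨ cong (_% suc n) (ℕ.m∸n+n≡m (ℕ.<⇒≤ (toℕ<n a))) ⟩
    suc n % suc n
      ≡⟨ n%n≡0 (suc n) ⟩
    0 ∎)
    where open ≡-Reasoning

  isGroup : IsGroup _≡_ _⊕_ zero ⊖_
  isGroup = record
    { isMonoid = record
      { isSemigroup = record
        { isMagma = record { isEquivalence = isEquivalence ; ∙-cong = cong₂ _⊕_ }
        ; assoc = ⊕-assoc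
        }
      ; identity = ⊕-identityˡ , λ a → trans (⊕-comm a zero) (⊕-identityˡ a)
      }
    ; inverse = ⊖-inverseˡ , λ a → trans (⊕-comm a (⊖ a)) (⊖-inverseˡ a)
    ; ⁻¹-cong = cong ⊖_
    }

-- Near-orthomorphisms

≡-group : {G : Set} {_∙_ : Op₂ G} {ε : G} {_⁻¹ : Op₁ G} → IsGroup _≡_ _∙_ ε _⁻¹ → Group 0ℓ 0ℓ
≡-group isGroup = record { isGroup = isGroup }

record NearOrthomorphism {G : Set} (_∙_ : Op₂ G) (ε : G) : Set where
  field
    ρ π : G → G
    ρ-injective : Injective _≡_ _≡_ ρ
    π-injective : Injective _≡_ _≡_ π
    ρ≡∙π∘ρ : ∀ c → ρ c ≢ ε → ρ c ≡ c ∙ π (ρ c)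

module _ {G : Set} {_∙_ : Op₂ G} {ε : G} {_⁻¹ : Op₁ G} (isGroup : IsGroup _≡_ _∙_ ε _⁻¹) where
  open IsGroup isGroup using (assoc; inverseʳ; _\\_; _//_)
  open GroupProperties (≡-group isGroup)
    using (quasigroup; ⁻¹-injective; \\-leftDividesˡ; //-rightDividesˡ)
  open QuasigroupProperties quasigroup using (cancelʳ)

  -- ρ c = κ (c ⁻¹) // z: inverting the argument turns the condition into one on κ,
  -- and the right translation by z ⁻¹ moves the exceptional value z to ε.
  nearOrthomorphism : (κ π : G → G) (z : G) → Injective _≡_ _≡_ κ → Injective _≡_ _≡_ π →
    (∀ w → κ w ≢ z → π (κ w) ≡ w ∙ κ w) → NearOrthomorphism _∙_ ε
  nearOrthomorphism κ π z κ-injective π-injective π∘κ≡∙κ = record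
    { ρ = ρ
    ; π = λ r → π (r ∙ z) // z
    ; ρ-injective = ⁻¹-injective ∘ κ-injective ∘ cancelʳ (z ⁻¹) _ _
    ; π-injective = cancelʳ z _ _ ∘ π-injective ∘ cancelʳ (z ⁻¹) _ _
    ; ρ≡∙π∘ρ = ρ≡∙π∘ρ
    }
    where
    ρ : G → G
    ρ c = κ (c ⁻¹) // z

    ρ≡∙π∘ρ : ∀ c → ρ c ≢ ε → ρ c ≡ c ∙ (π (ρ c ∙ z) // z)
    ρ≡∙π∘ρ c ρc≢ε = sym (begin
      c ∙ (π (ρ c ∙ z) // z)        ≡⟨ cong (λ r → c ∙ (π r // z)) (//-rightDividesˡ z (κ (c ⁻¹))) ⟩
      c ∙ (π (κ (c ⁻¹)) // z)       ≡⟨ cong (λ r → c ∙ (r // z)) (π∘κ≡∙κ (c ⁻¹) κc⁻¹≢z) ⟩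
      c ∙ ((c \\ κ (c ⁻¹)) // z)    ≡⟨ assoc c (c \\ κ (c ⁻¹)) (z ⁻¹) ⟨
      (c ∙ (c \\ κ (c ⁻¹))) // z    ≡⟨ cong (_// z) (\\-leftDividesˡ c (κ (c ⁻¹))) ⟩
      ρ c                           ∎)
      where
      open ≡-Reasoning
      κc⁻¹≢z : κ (c ⁻¹) ≢ z
      κc⁻¹≢z κc⁻¹≡z = ρc≢ε (trans (cong (_// z) κc⁻¹≡z) (inverseʳ z))

↑-elim : ∀ {m n} {P : Fin (m + n) → Set} → (∀ i → P (i ↑ˡ n)) → (∀ j → P (m ↑ʳ j)) → ∀ w → P w
↑-elim {m} {n} {P} P↑ˡ P↑ʳ w = subst P (join-splitAt m n w) (by-cases (splitAt m w))
  where
  by-cases : ∀ v → P (join m n v)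
  by-cases (inj₁ i) = P↑ˡ i
  by-cases (inj₂ j) = P↑ʳ j

splitAt-injective : ∀ m {n} → Injective _≡_ _≡_ (splitAt m {n})
splitAt-injective m {n} {w} {w'} eq =
  trans (sym (join-splitAt m n w)) (trans (cong (join m n) eq) (join-splitAt m n w'))

join-injective : ∀ m n → Injective _≡_ _≡_ (join m n)
join-injective m n {v} {v'} eq =
  trans (sym (splitAt-join m n v)) (trans (cong (splitAt m) eq) (splitAt-join m n v'))

interleave : ∀ {a b} → Fin a ⊎ Fin b → ℕ
interleave (inj₁ i) = 2 * toℕ i
interleave (inj₂ j) = suc (2 * toℕ j)

interleave-injective : ∀ {a b} → Injective _≡_ _≡_ (interleave {a} {b})
interleave-injective {x = inj₁ i} {inj₁ i'} eq = cong inj₁ (toℕ-injective (ℕ.*-cancelˡ-≡ _ _ 2 eq))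
interleave-injective {x = inj₁ i} {inj₂ j}  eq = contradiction eq (ℕ.even≢odd (toℕ i) (toℕ j))
interleave-injective {x = inj₂ j} {inj₁ i}  eq = contradiction (sym eq) (ℕ.even≢odd (toℕ i) (toℕ j))
interleave-injective {x = inj₂ j} {inj₂ j'} eq =
  cong inj₂ (toℕ-injective (ℕ.*-cancelˡ-≡ _ _ 2 (ℕ.suc-injective eq)))

interleave< : ∀ {a b} → b ≤ a → a ≤ suc b → ∀ v → interleave {a} {b} v < a + b
interleave< {a} {b} b≤a a≤1+b (inj₁ i) = subst (_≤ a + b) (double+1 (toℕ i))
  (ℕ.+-mono-≤ (toℕ<n i) (ℕ.s≤s⁻¹ (ℕ.≤-trans (toℕ<n i) a≤1+b)))
  where
  double+1 : ∀ x → suc x + x ≡ suc (2 * x)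
  double+1 = solve-∀
interleave< {a} {b} b≤a a≤1+b (inj₂ j) = subst (_≤ a + b) (double+2 (toℕ j))
  (ℕ.+-mono-≤ (ℕ.≤-trans (toℕ<n j) b≤a) (toℕ<n j))
  where
  double+2 : ∀ x → suc x + suc x ≡ suc (suc (2 * x))
  double+2 = solve-∀

module Interleaving (a' b : ℕ) (b≤a : b ≤ suc a') (a≤1+b : suc a' ≤ suc b) where
  open Cyclic (a' + b) using (_⊕_; mod-injective)

  interleaving : Fin (suc a' + b) → Fin (suc a' + b)
  interleaving r = interleave (splitAt (suc a') r) mod suc (a' + b)

  interleaving-injective : Injective _≡_ _≡_ interleaving
  interleaving-injective {r} {r'} = splitAt-injective (suc a') ∘ interleave-injective ∘
    mod-injective (interleave< b≤a a≤1+b (splitAt (suc a') r))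
                  (interleave< b≤a a≤1+b (splitAt (suc a') r'))

  interleaving-↑ˡ : ∀ i → interleaving (i ↑ˡ b) ≡ (i ↑ˡ b) ⊕ (i ↑ˡ b)
  interleaving-↑ˡ i = begin
    interleave (splitAt (suc a') (i ↑ˡ b)) mod suc (a' + b)
      ≡⟨ cong (λ v → interleave v mod suc (a' + b)) (splitAt-↑ˡ (suc a') i b) ⟩
    (2 * toℕ i) mod suc (a' + b)
      ≡⟨ cong (_mod suc (a' + b)) (double (toℕ i)) ⟩
    (toℕ i + toℕ i) mod suc (a' + b)
      ≡⟨ cong₂ (λ x y → (x + y) mod suc (a' + b)) (toℕ-↑ˡ i b) (toℕ-↑ˡ i b) ⟨
    (i ↑ˡ b) ⊕ (i ↑ˡ b)
      ∎
    where
    open ≡-Reasoning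
    double : ∀ x → 2 * x ≡ x + x
    double = solve-∀

  interleaving-↑ʳ : ∀ j → interleaving (suc a' ↑ʳ j) ≡ suc (2 * toℕ j) mod suc (a' + b)
  interleaving-↑ʳ j = cong (λ v → interleave v mod suc (a' + b)) (splitAt-↑ʳ (suc a') b j)

-- For t = 2u + 1, κ = id and π r = r ⊕ r, computed by interleave to make it visibly injective.
oddNearOrthomorphism : ∀ u → NearOrthomorphism (Cyclic._⊕_ (u + u)) zero
oddNearOrthomorphism u = nearOrthomorphism (Cyclic.isGroup (u + u)) id interleaving zero
  id interleaving-injective (λ w _ → interleaving≡double w)
  where
  open Cyclic (u + u) using (_⊕_; mod-+-modulus)
  open Interleaving u u (ℕ.n≤1+n u) ℕ.≤-refl

  interleaving≡double : ∀ w → interleaving w ≡ w ⊕ w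
  interleaving≡double = ↑-elim interleaving-↑ˡ λ j → begin
    interleaving (suc u ↑ʳ j)
      ≡⟨ interleaving-↑ʳ j ⟩
    suc (2 * toℕ j) mod suc (u + u)
      ≡⟨ mod-+-modulus (suc (2 * toℕ j)) ⟨
    (suc (2 * toℕ j) + suc (u + u)) mod suc (u + u)
      ≡⟨ cong (_mod suc (u + u)) (wrap u (toℕ j)) ⟩
    ((suc u + toℕ j) + (suc u + toℕ j)) mod suc (u + u)
      ≡⟨ cong (λ x → (x + x) mod suc (u + u)) (toℕ-↑ʳ (suc u) j) ⟨
    (suc u ↑ʳ j) ⊕ (suc u ↑ʳ j)
      ∎
    where
    open ≡-Reasoning
    wrap : ∀ u x → suc (2 * x) + suc (u + u) ≡ (suc u + x) + (suc u + x)
    wrap = solve-∀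

rotate : ∀ {n} → Fin (suc n) → Fin (suc n)
rotate zero    = fromℕ _
rotate (suc j) = inject₁ j

rotate-injective : ∀ {n} → Injective _≡_ _≡_ (rotate {n})
rotate-injective {x = zero}  {zero}  _  = refl
rotate-injective {x = zero}  {suc j} eq = contradiction eq fromℕ≢inject₁
rotate-injective {x = suc i} {zero}  eq = contradiction (sym eq) fromℕ≢inject₁
rotate-injective {x = suc i} {suc j} eq = cong suc (inject₁-injective eq)

-- For t = 2h, π maps the lower half r < h to 2r and the upper half h + j to 2j + 1,
-- and κ is the identity on the lower half and w ↦ w − 1 on h < w < t; then
-- π (κ w) = w ⊕ κ w for w ≠ h, and κ h is the exceptional value t − 1.
evenNearOrthomorphism : ∀ h' → NearOrthomorphism (Cyclic._⊕_ (h' + suc h')) zero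
evenNearOrthomorphism h' =
  nearOrthomorphism (Cyclic.isGroup (h' + suc h')) κ interleaving (h ↑ʳ fromℕ h')
    κ-injective interleaving-injective π∘κ≡⊕κ
  where
  open Cyclic (h' + suc h') using (_⊕_; mod-+-modulus)
  h = suc h'
  open Interleaving h' h ℕ.≤-refl (ℕ.n≤1+n h)

  κ : Fin (h + h) → Fin (h + h)
  κ w = join h h (map₂ rotate (splitAt h w))

  κ-↑ˡ : ∀ i → κ (i ↑ˡ h) ≡ i ↑ˡ h
  κ-↑ˡ i = cong (join h h ∘ map₂ rotate) (splitAt-↑ˡ h i h)

  κ-↑ʳ : ∀ j → κ (h ↑ʳ j) ≡ h ↑ʳ rotate j
  κ-↑ʳ j = cong (join h h ∘ map₂ rotate) (splitAt-↑ʳ h h j)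

  map₂-rotate-injective : Injective _≡_ _≡_ (map₂ {A = Fin h} (rotate {h'}))
  map₂-rotate-injective {inj₁ i} {inj₁ i'} eq = eq
  map₂-rotate-injective {inj₂ j} {inj₂ j'} eq = cong inj₂ (rotate-injective (inj₂-injective eq))

  κ-injective : Injective _≡_ _≡_ κ
  κ-injective = splitAt-injective h ∘ map₂-rotate-injective ∘ join-injective h h

  π∘κ≡⊕κ : ∀ w → κ w ≢ h ↑ʳ fromℕ h' → interleaving (κ w) ≡ w ⊕ κ w
  π∘κ≡⊕κ = ↑-elim
    (λ i _ → subst (λ r → interleaving r ≡ (i ↑ˡ h) ⊕ r) (sym (κ-↑ˡ i)) (interleaving-↑ˡ i))
    λ { zero κw≢z → contradiction (κ-↑ʳ zero) κw≢z
      ; (suc j) _ → begin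
        interleaving (κ (h ↑ʳ suc j))
          ≡⟨ cong interleaving (κ-↑ʳ (suc j)) ⟩
        interleaving (h ↑ʳ inject₁ j)
          ≡⟨ interleaving-↑ʳ (inject₁ j) ⟩
        suc (2 * toℕ (inject₁ j)) mod suc (h' + h)
          ≡⟨ cong (λ x → suc (2 * x) mod suc (h' + h)) (toℕ-inject₁ j) ⟩
        suc (2 * toℕ j) mod suc (h' + h)
          ≡⟨ mod-+-modulus (suc (2 * toℕ j)) ⟨
        (suc (2 * toℕ j) + (h + h)) mod suc (h' + h)
          ≡⟨ cong (_mod suc (h' + h)) (wrap h (toℕ j)) ⟩
        ((h + suc (toℕ j)) + (h + toℕ j)) mod suc (h' + h)
          ≡⟨ cong₂ (λ x y → (x + y) mod suc (h' + h)) (toℕ-↑ʳ h (suc j))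
                   (trans (toℕ-↑ʳ h (inject₁ j)) (cong (h +_) (toℕ-inject₁ j))) ⟨
        (h ↑ʳ suc j) ⊕ (h ↑ʳ inject₁ j)
          ≡⟨ cong ((h ↑ʳ suc j) ⊕_) (κ-↑ʳ (suc j)) ⟨
        (h ↑ʳ suc j) ⊕ κ (h ↑ʳ suc j)
          ∎ }
    where
    open ≡-Reasoning
    wrap : ∀ h x → suc (2 * x) + (h + h) ≡ (h + suc x) + (h + x)
    wrap = solve-∀

even⊎odd : ∀ n → ∃ λ u → n ≡ u + u ⊎ n ≡ u + suc u
even⊎odd zero = 0 , inj₁ refl
even⊎odd (suc n) with even⊎odd n
... | u , inj₁ n≡u+u   = u , inj₂ (trans (cong suc n≡u+u) (sym (ℕ.+-suc u u)))
... | u , inj₂ n≡u+1+u = suc u , inj₁ (cong suc n≡u+1+u)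

cyclicNearOrthomorphism : ∀ n → NearOrthomorphism (Cyclic._⊕_ n) zero
cyclicNearOrthomorphism n with even⊎odd n
... | u , inj₁ refl = oddNearOrthomorphism u
... | u , inj₂ refl = evenNearOrthomorphism u

-- Prolongation of a group by a near-orthomorphism

record LatinSquareWithSubsquare (S T : Set) : Set where
  field
    _⊛_ : Op₂ (S ⊎ T)
    cancelˡ : LeftCancellative _≡_ _⊛_
    cancelʳ : RightCancellative _≡_ _⊛_
    inj₁⊛inj₁ : ∀ s s' → ∃ λ s'' → inj₁ s ⊛ inj₁ s' ≡ inj₁ s''
    inj₁⊛inj₂ : ∀ s b → ∃ λ b' → inj₁ s ⊛ inj₂ b ≡ inj₂ b'
    inj₂⊛inj₁ : ∀ a s → ∃ λ b' → inj₂ a ⊛ inj₁ s ≡ inj₂ b'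

-- The new symbol s displaces the residue e s, and d is the partial inverse of e.  The
-- residue ε must be displaced, as the near-orthomorphism may fail there.
module Prolongation
  {G : Set} {_∙_ : Op₂ G} {ε : G} {_⁻¹ : Op₁ G} (isGroup : IsGroup _≡_ _∙_ ε _⁻¹)
  (N : NearOrthomorphism _∙_ ε)
  {S : Set} {_⊙_ : Op₂ S}
  (⊙-cancelˡ : LeftCancellative _≡_ _⊙_) (⊙-cancelʳ : RightCancellative _≡_ _⊙_)
  (e : S → G) (d : G → Maybe S)
  (d∘e≡just : ∀ s → d (e s) ≡ just s) (d≡just⇒e : ∀ {r s} → d r ≡ just s → e s ≡ r)
  (ε∈e : ∃ λ s → e s ≡ ε)
  where

  open IsGroup isGroup using (assoc; _\\_)
  open GroupProperties (≡-group isGroup) using (quasigroup; \\-leftDividesˡ)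
  open QuasigroupProperties quasigroup using () renaming (cancelˡ to ∙-cancelˡ; cancelʳ to ∙-cancelʳ)
  open NearOrthomorphism N

  private
    e-injective : ∀ {s s'} → e s ≡ e s' → s ≡ s'
    e-injective {s} {s'} es≡es' =
      just-injective (trans (sym (d∘e≡just s)) (trans (cong d es≡es') (d∘e≡just s')))

    undisplaced⇒≢e : ∀ {r} s → d r ≡ nothing → e s ≢ r
    undisplaced⇒≢e s dr≡nothing es≡r =
      contradiction (trans (sym dr≡nothing) (trans (cong d (sym es≡r)) (d∘e≡just s))) λ ()

    \\-injectiveʳ : ∀ a {b b'} → a \\ b ≡ a \\ b' → b ≡ b'
    \\-injectiveʳ a {b} {b'} eq =
      trans (sym (\\-leftDividesˡ a b)) (trans (cong (a ∙_) eq) (\\-leftDividesˡ a b'))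

    \\-injectiveˡ : ∀ {a a'} b → a \\ b ≡ a' \\ b → a ≡ a'
    \\-injectiveˡ {a} {a'} b eq = ∙-cancelʳ (a' \\ b) a a'
      (trans (cong (a ∙_) (sym eq)) (trans (\\-leftDividesˡ a b) (sym (\\-leftDividesˡ a' b))))

    undisplaced : ∀ a b → d (ρ (a \\ b)) ≡ nothing → a ∙ ρ (a \\ b) ≡ b ∙ π (ρ (a \\ b))
    undisplaced a b d≡nothing = begin
      a ∙ ρ c              ≡⟨ cong (a ∙_) (ρ≡∙π∘ρ c ρc≢ε) ⟩
      a ∙ (c ∙ π (ρ c))    ≡⟨ assoc a c (π (ρ c)) ⟨
      (a ∙ c) ∙ π (ρ c)    ≡⟨ cong (_∙ π (ρ c)) (\\-leftDividesˡ a b) ⟩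
      b ∙ π (ρ c)          ∎
      where
      open ≡-Reasoning
      c = a \\ b
      ρc≢ε : ρ c ≢ ε
      ρc≢ε ρc≡ε = let s , es≡ε = ε∈e in undisplaced⇒≢e s d≡nothing (trans es≡ε (sym ρc≡ε))

  displace : G → G → S ⊎ G
  displace a r = maybe′ inj₁ (inj₂ (a ∙ r)) (d r)

  private
    displace-injectiveʳ : ∀ a {r r'} → displace a r ≡ displace a r' → r ≡ r'
    displace-injectiveʳ a {r} {r'} eq with d r in dr | d r' in dr'
    ... | just s  | just s' =
      trans (sym (d≡just⇒e dr)) (trans (cong e (inj₁-injective eq)) (d≡just⇒e dr'))
    ... | just _  | nothing = contradiction eq λ ()
    ... | nothing | just _  = contradiction eq λ ()
    ... | nothing | nothing = ∙-cancelˡ a r r' (inj₂-injective eq)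

    displace-injectiveˡ : ∀ {a a'} b → displace a (ρ (a \\ b)) ≡ displace a' (ρ (a' \\ b)) →
      ρ (a \\ b) ≡ ρ (a' \\ b)
    displace-injectiveˡ {a} {a'} b eq with d (ρ (a \\ b)) in dr | d (ρ (a' \\ b)) in dr'
    ... | just s  | just s' =
      trans (sym (d≡just⇒e dr)) (trans (cong e (inj₁-injective eq)) (d≡just⇒e dr'))
    ... | just _  | nothing = contradiction eq λ ()
    ... | nothing | just _  = contradiction eq λ ()
    ... | nothing | nothing = π-injective (∙-cancelˡ b _ _
      (trans (sym (undisplaced a b dr)) (trans (inj₂-injective eq) (undisplaced a' b dr'))))

    displace≢inj₂ʳ : ∀ a r s → inj₂ (a ∙ e s) ≢ displace a r
    displace≢inj₂ʳ a r s with d r in dr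
    ... | just _  = λ ()
    ... | nothing = λ eq → undisplaced⇒≢e s dr (∙-cancelˡ a _ _ (inj₂-injective eq))

    displace≢inj₂ˡ : ∀ a b s → inj₂ (b ∙ π (e s)) ≢ displace a (ρ (a \\ b))
    displace≢inj₂ˡ a b s with d (ρ (a \\ b)) in dr
    ... | just _  = λ ()
    ... | nothing = λ eq → undisplaced⇒≢e s dr (π-injective (∙-cancelˡ b _ _
      (trans (inj₂-injective eq) (undisplaced a b dr))))

  _⊛_ : Op₂ (S ⊎ G)
  inj₁ s ⊛ inj₁ s' = inj₁ (s ⊙ s')
  inj₁ s ⊛ inj₂ b  = inj₂ (b ∙ π (e s))
  inj₂ a ⊛ inj₁ s  = inj₂ (a ∙ e s)
  inj₂ a ⊛ inj₂ b  = displace a (ρ (a \\ b))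

  ⊛-cancelˡ : LeftCancellative _≡_ _⊛_
  ⊛-cancelˡ (inj₁ s) (inj₁ t) (inj₁ t') eq = cong inj₁ (⊙-cancelˡ s t t' (inj₁-injective eq))
  ⊛-cancelˡ (inj₁ s) (inj₂ b) (inj₂ b') eq = cong inj₂ (∙-cancelʳ (π (e s)) b b' (inj₂-injective eq))
  ⊛-cancelˡ (inj₂ a) (inj₁ t) (inj₁ t') eq = cong inj₁ (e-injective (∙-cancelˡ a _ _ (inj₂-injective eq)))
  ⊛-cancelˡ (inj₂ a) (inj₂ b) (inj₂ b') eq =
    cong inj₂ (\\-injectiveʳ a (ρ-injective (displace-injectiveʳ a eq)))
  ⊛-cancelˡ (inj₂ a) (inj₁ t) (inj₂ b') eq = contradiction eq (displace≢inj₂ʳ a _ t)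
  ⊛-cancelˡ (inj₂ a) (inj₂ b) (inj₁ t') eq = contradiction (sym eq) (displace≢inj₂ʳ a _ t')

  ⊛-cancelʳ : RightCancellative _≡_ _⊛_
  ⊛-cancelʳ (inj₁ s) (inj₁ t) (inj₁ t') eq = cong inj₁ (⊙-cancelʳ s t t' (inj₁-injective eq))
  ⊛-cancelʳ (inj₁ s) (inj₂ a) (inj₂ a') eq = cong inj₂ (∙-cancelʳ (e s) a a' (inj₂-injective eq))
  ⊛-cancelʳ (inj₂ b) (inj₁ t) (inj₁ t') eq =
    cong inj₁ (e-injective (π-injective (∙-cancelˡ b _ _ (inj₂-injective eq))))
  ⊛-cancelʳ (inj₂ b) (inj₂ a) (inj₂ a') eq =
    cong inj₂ (\\-injectiveˡ b (ρ-injective (displace-injectiveˡ b eq)))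
  ⊛-cancelʳ (inj₂ b) (inj₁ t) (inj₂ a') eq = contradiction eq (displace≢inj₂ˡ a' b t)
  ⊛-cancelʳ (inj₂ b) (inj₂ a) (inj₁ t') eq = contradiction (sym eq) (displace≢inj₂ˡ a b t')

  latinSquareWithSubsquare : LatinSquareWithSubsquare S G
  latinSquareWithSubsquare = record
    { _⊛_ = _⊛_
    ; cancelˡ = ⊛-cancelˡ
    ; cancelʳ = ⊛-cancelʳ
    ; inj₁⊛inj₁ = λ _ _ → _ , refl
    ; inj₁⊛inj₂ = λ _ _ → _ , refl
    ; inj₂⊛inj₁ = λ _ _ → _ , refl
    }

cyclicLatinSquareWithSubsquare : ∀ m t → 1 ≤ m → m ≤ t → LatinSquareWithSubsquare (Fin m) (Fin t)
cyclicLatinSquareWithSubsquare (suc m') t (s≤s z≤n) m≤t with d' , refl ← ℕ.m≤n⇒∃[o]m+o≡n m≤t =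
  Prolongation.latinSquareWithSubsquare (Cyclic.isGroup (m' + d')) (cyclicNearOrthomorphism (m' + d'))
    cancelˡ cancelʳ (_↑ˡ d') displaced
    (λ s → cong [ just , const nothing ]′ (splitAt-↑ˡ (suc m') s d')) displaced⇒↑ˡ (zero , refl)
  where
  open QuasigroupProperties (GroupProperties.quasigroup (≡-group (Cyclic.isGroup m')))
    using (cancelˡ; cancelʳ)

  displaced : Fin (suc m' + d') → Maybe (Fin (suc m'))
  displaced r = [ just , const nothing ]′ (splitAt (suc m') r)

  displaced⇒↑ˡ : ∀ {r s} → displaced r ≡ just s → s ↑ˡ d' ≡ r
  displaced⇒↑ˡ {r} eq with splitAt (suc m') r in split
  ... | inj₁ s = subst (λ s → s ↑ˡ d' ≡ r) (just-injective eq) (splitAt⁻¹-↑ˡ split)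
  ... | inj₂ _ = contradiction eq λ ()

-- Subsets of Fin k

separate : ∀ {k} (Ω : Subset k) → Fin k → Fin ∣ Ω ∣ ⊎ Fin ∣ ∁ Ω ∣
separate (inside  ∷ Ω) zero    = inj₁ zero
separate (outside ∷ Ω) zero    = inj₂ zero
separate (inside  ∷ Ω) (suc x) = map₁ suc (separate Ω x)
separate (outside ∷ Ω) (suc x) = map₂ suc (separate Ω x)

merge : ∀ {k} (Ω : Subset k) → Fin ∣ Ω ∣ ⊎ Fin ∣ ∁ Ω ∣ → Fin k
merge (inside  ∷ Ω) (inj₁ zero)    = zero
merge (inside  ∷ Ω) (inj₁ (suc i)) = suc (merge Ω (inj₁ i))
merge (inside  ∷ Ω) (inj₂ j)       = suc (merge Ω (inj₂ j))
merge (outside ∷ Ω) (inj₁ i)       = suc (merge Ω (inj₁ i))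
merge (outside ∷ Ω) (inj₂ zero)    = zero
merge (outside ∷ Ω) (inj₂ (suc j)) = suc (merge Ω (inj₂ j))

merge-separate : ∀ {k} (Ω : Subset k) x → merge Ω (separate Ω x) ≡ x
merge-separate (inside  ∷ Ω) zero = refl
merge-separate (outside ∷ Ω) zero = refl
merge-separate (inside  ∷ Ω) (suc x) with separate Ω x | merge-separate Ω x
... | inj₁ _ | eq = cong suc eq
... | inj₂ _ | eq = cong suc eq
merge-separate (outside ∷ Ω) (suc x) with separate Ω x | merge-separate Ω x
... | inj₁ _ | eq = cong suc eq
... | inj₂ _ | eq = cong suc eq

separate-merge : ∀ {k} (Ω : Subset k) v → separate Ω (merge Ω v) ≡ v
separate-merge (inside  ∷ Ω) (inj₁ zero)    = refl
separate-merge (inside  ∷ Ω) (inj₁ (suc i)) = cong (map₁ suc) (separate-merge Ω (inj₁ i))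
separate-merge (inside  ∷ Ω) (inj₂ j)       = cong (map₁ suc) (separate-merge Ω (inj₂ j))
separate-merge (outside ∷ Ω) (inj₁ i)       = cong (map₂ suc) (separate-merge Ω (inj₁ i))
separate-merge (outside ∷ Ω) (inj₂ zero)    = refl
separate-merge (outside ∷ Ω) (inj₂ (suc j)) = cong (map₂ suc) (separate-merge Ω (inj₂ j))

separate-injective : ∀ {k} (Ω : Subset k) → Injective _≡_ _≡_ (separate Ω)
separate-injective Ω {x} {y} eq =
  trans (sym (merge-separate Ω x)) (trans (cong (merge Ω) eq) (merge-separate Ω y))

merge-injective : ∀ {k} (Ω : Subset k) → Injective _≡_ _≡_ (merge Ω)
merge-injective Ω {v} {w} eq =
  trans (sym (separate-merge Ω v)) (trans (cong (separate Ω) eq) (separate-merge Ω w))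

merge-inj₁-∈ : ∀ {k} (Ω : Subset k) i → merge Ω (inj₁ i) ∈ Ω
merge-inj₁-∈ (inside  ∷ Ω) zero    = here
merge-inj₁-∈ (inside  ∷ Ω) (suc i) = there (merge-inj₁-∈ Ω i)
merge-inj₁-∈ (outside ∷ Ω) i       = there (merge-inj₁-∈ Ω i)

merge-inj₂-∉ : ∀ {k} (Ω : Subset k) j → merge Ω (inj₂ j) ∉ Ω
merge-inj₂-∉ (inside  ∷ Ω) j       (there p) = merge-inj₂-∉ Ω j p
merge-inj₂-∉ (outside ∷ Ω) zero    ()
merge-inj₂-∉ (outside ∷ Ω) (suc j) (there p) = merge-inj₂-∉ Ω j p

module _ {k} (Ω : Subset k) where

  ∈⇒separate≡inj₁ : ∀ {x} → x ∈ Ω → ∃ λ i → separate Ω x ≡ inj₁ i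
  ∈⇒separate≡inj₁ {x} x∈Ω with separate Ω x in eq
  ... | inj₁ i = i , refl
  ... | inj₂ j = contradiction x∈Ω
    (subst (_∉ Ω) (trans (cong (merge Ω) (sym eq)) (merge-separate Ω x)) (merge-inj₂-∉ Ω j))

  ∉⇒separate≡inj₂ : ∀ {x} → x ∉ Ω → ∃ λ j → separate Ω x ≡ inj₂ j
  ∉⇒separate≡inj₂ {x} x∉Ω with separate Ω x in eq
  ... | inj₂ j = j , refl
  ... | inj₁ i = contradiction
    (subst (_∈ Ω) (trans (cong (merge Ω) (sym eq)) (merge-separate Ω x)) (merge-inj₁-∈ Ω i)) x∉Ω

module Transport {k} (Ω : Subset k) (L : LatinSquareWithSubsquare (Fin ∣ Ω ∣) (Fin ∣ ∁ Ω ∣)) where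
  open LatinSquareWithSubsquare L

  _∙_ : Op₂ (Fin k)
  x ∙ y = merge Ω (separate Ω x ⊛ separate Ω y)

  private
    merge-inj₁ : ∀ {v} → (∃ λ i → v ≡ inj₁ i) → merge Ω v ∈ Ω
    merge-inj₁ (i , refl) = merge-inj₁-∈ Ω i

    merge-inj₂ : ∀ {v} → (∃ λ j → v ≡ inj₂ j) → merge Ω v ∉ Ω
    merge-inj₂ (j , refl) = merge-inj₂-∉ Ω j

  ∙-cancelˡ : LeftCancellative _≡_ _∙_
  ∙-cancelˡ x y y' = separate-injective Ω ∘ cancelˡ (separate Ω x) _ _ ∘ merge-injective Ω

  ∙-cancelʳ : RightCancellative _≡_ _∙_
  ∙-cancelʳ y x x' = separate-injective Ω ∘ cancelʳ (separate Ω y) _ _ ∘ merge-injective Ω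

  ∙-closed : ∀ {x y} → x ∈ Ω → y ∈ Ω → x ∙ y ∈ Ω
  ∙-closed x∈Ω y∈Ω with i , eqˣ ← ∈⇒separate≡inj₁ Ω x∈Ω | j , eqʸ ← ∈⇒separate≡inj₁ Ω y∈Ω
    rewrite eqˣ | eqʸ = merge-inj₁ (inj₁⊛inj₁ i j)

  ∙-absorbʳ : ∀ {x y} → x ∈ Ω → y ∉ Ω → x ∙ y ∉ Ω
  ∙-absorbʳ x∈Ω y∉Ω with i , eqˣ ← ∈⇒separate≡inj₁ Ω x∈Ω | j , eqʸ ← ∉⇒separate≡inj₂ Ω y∉Ω
    rewrite eqˣ | eqʸ = merge-inj₂ (inj₁⊛inj₂ i j)

  ∙-absorbˡ : ∀ {x y} → x ∉ Ω → y ∈ Ω → x ∙ y ∉ Ω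
  ∙-absorbˡ x∉Ω y∈Ω with i , eqˣ ← ∉⇒separate≡inj₂ Ω x∉Ω | j , eqʸ ← ∈⇒separate≡inj₁ Ω y∈Ω
    rewrite eqˣ | eqʸ = merge-inj₂ (inj₂⊛inj₁ i j)

∣p∣≤n/2⇒∣p∣≤∣∁p∣ : ∀ {k} (p : Subset k) → ∣ p ∣ ≤ k / 2 → ∣ p ∣ ≤ ∣ ∁ p ∣
∣p∣≤n/2⇒∣p∣≤∣∁p∣ {k} p ∣p∣≤k/2 =
  subst (∣ p ∣ ≤_) (sym (∣∁p∣≡n∸∣p∣ p)) (ℕ.m+n≤o⇒m≤o∸n ∣ p ∣ ∣p∣+∣p∣≤k)
  where
  open ℕ.≤-Reasoning
  x+x≡x*2 : ∀ x → x + x ≡ x * 2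
  x+x≡x*2 = solve-∀
  ∣p∣+∣p∣≤k : ∣ p ∣ + ∣ p ∣ ≤ k
  ∣p∣+∣p∣≤k = begin
    ∣ p ∣ + ∣ p ∣  ≤⟨ ℕ.+-mono-≤ ∣p∣≤k/2 ∣p∣≤k/2 ⟩
    k / 2 + k / 2  ≡⟨ x+x≡x*2 (k / 2) ⟩
    k / 2 * 2      ≤⟨ m/n*n≤m k 2 ⟩
    k              ∎

quasigroupWithSubquasigroup : ∀ {k} (Ω : Subset k) → Nonempty Ω → ∣ Ω ∣ ≤ ∣ ∁ Ω ∣ →
  ∃ λ (_∙_ : Op₂ (Fin k)) → IsSubquasigroup₂ (λ _ → ⊤) _∙_ × IsSubquasigroup₂ (_∈ Ω) _∙_
quasigroupWithSubquasigroup Ω (x , x∈Ω) ∣Ω∣≤∣∁Ω∣ =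
  _∙_ , isSubquasigroup₂-⊤ , isSubquasigroup₂ (_∈? Ω) ∙-closed ∙-absorbʳ ∙-absorbˡ
  where
  1≤∣Ω∣ : 1 ≤ ∣ Ω ∣
  1≤∣Ω∣ = let i , _ = ∈⇒separate≡inj₁ Ω x∈Ω in ℕ.≤-<-trans z≤n (toℕ<n i)
  open Transport Ω (cyclicLatinSquareWithSubsquare ∣ Ω ∣ ∣ ∁ Ω ∣ 1≤∣Ω∣ ∣Ω∣≤∣∁Ω∣)
  open FiniteCancellative ∙-cancelˡ ∙-cancelʳ

lemma2 : (n k : ℕ) → 3 ≤ n → (Ω : Subset k) → Nonempty Ω → ∣ Ω ∣ ≤ k / 2 →
    Σ (Op n (Fin k)) λ q → IsReducible n q × IsClosed n (_∈ Ω) q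
lemma2 (suc zero) k (s≤s ()) Ω nonempty ∣Ω∣≤k/2
lemma2 (suc (suc zero)) k (s≤s (s≤s ())) Ω nonempty ∣Ω∣≤k/2
lemma2 (suc (suc (suc n))) k _ Ω nonempty ∣Ω∣≤k/2
  with _∙_ , quasigroup , subquasigroup ←
         quasigroupWithSubquasigroup Ω nonempty (∣p∣≤n/2⇒∣p∣≤∣∁p∣ Ω ∣Ω∣≤k/2) =
  chain _∙_ (suc (suc n)) , isReducible-chain quasigroup n , isClosed-chain subquasigroup (suc (suc n))
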